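{- Let $k,n\in\mathbb{N}$, let $q$ be a prime, let $m=\Theta(k^2\log n)$, let $B\subseteq\mathbb{F}_q^m$ with $|B|=n$, and let $\ell:=12\log_q n$. Select $\ell$ matrices $A_1,\ldots,A_\ell\in\mathbb{F}_q^{k\times m}$ uniformly and independently at random, and for $\vec b\in\mathbb{F}_q^m$ let $g(\vec{b}):=(A_1\vec{b},\ldots,A_\ell\vec{b})\in\mathbb{F}_q^{k\ell}$. Let $\tilde{B}_k:=\{\sum_{i\in[k]}\gamma_i\vec{b}_i:\gamma_1,\ldots,\gamma_k\in\mathbb{F}_q,\ \vec{b}_1,\ldots,\vec{b}_k\in B\}$. Suppose $q>2^{12k}$ but $q=O_k(1)$. Then with probability at least $1-\frac{O_k(1)}{n^k}$, for every $\vec{b}\in\tilde{B}_k\setminus\{\vec{0}\}$ we have $\|g(\vec{b})\|\ge 2/3$.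
   Context: For $x\in\mathbb{F}_q^D$, $\|x\|$ denotes the relative Hamming weight, i.e. the fraction of coordinates $i\in[D]$ with $x_i\neq 0$. $O_k(1)$ denotes a quantity bounded by a function of $k$ only (independent of $n$). -}

module Defs where

open import Data.Bool using (Bool; true; false; not; _∧_; if_then_else_)
open import Data.Nat using (ℕ; zero; suc; _+_; _*_; _^_; _≤ᵇ_)
open import Data.Nat.Divisibility using (_∣?_)
open import Data.Fin using (Fin; toℕ)
open import Data.List as L using (List; []; _∷_; concatMap; allFin)
open import Data.Bool.ListAction using (any)
open import Data.Vec as V using (Vec; []; _∷_; lookup; zipWith; replicate)
open import Relation.Nullary.Decidable using (⌊_⌋)

-- Elements of F_q are represented by Fin q (i.e. residues 0..q-1, arithmetic mod q).
-- Arithmetic is carried out in ℕ on representatives; an element x of ℕ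
-- represents 0 ∈ F_q iff q ∣ x.

allVecs : {A : Set} → List A → (k : ℕ) → List (Vec A k)
allVecs xs zero = [] ∷ []
allVecs xs (suc k) = concatMap (λ x → L.map (x ∷_) (allVecs xs k)) xs

dot : {m : ℕ} → Vec ℕ m → Vec ℕ m → ℕ
dot [] [] = 0
dot (x ∷ xs) (y ∷ ys) = x * y + dot xs ys

toℕs : {q m : ℕ} → Vec (Fin q) m → Vec ℕ m
toℕs = V.map toℕ

combo : {q m n k : ℕ} → Vec (Vec (Fin q) m) n → Vec (Fin q) k → Vec (Fin n) k → Vec ℕ m
combo B [] [] = replicate _ 0
combo B (g ∷ γ) (i ∷ idx) =
  zipWith _+_ (V.map (toℕ g *_) (toℕs (lookup B i))) (combo B γ idx)

isZeroMod : (q : ℕ) {m : ℕ} → Vec ℕ m → Bool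
isZeroMod q [] = true
isZeroMod q (x ∷ xs) = ⌊ q ∣? x ⌋ ∧ isZeroMod q xs

nzCount : (q : ℕ) {m : ℕ} → Vec ℕ m → ℕ
nzCount q [] = 0
nzCount q (x ∷ xs) = (if ⌊ q ∣? x ⌋ then 0 else 1) + nzCount q xs

Mat : ℕ → ℕ → ℕ → Set
Mat q k m = Vec (Vec (Fin q) m) k

matVec : {q k m : ℕ} → Mat q k m → Vec ℕ m → Vec ℕ k
matVec M b = V.map (λ row → dot (toℕs row) b) M

gMap : {q k m ℓ : ℕ} → Vec (Mat q k m) ℓ → Vec ℕ m → Vec (Vec ℕ k) ℓ
gMap As b = V.map (λ M → matVec M b) As

nzBlocks : (q : ℕ) {k ℓ : ℕ} → Vec (Vec ℕ k) ℓ → ℕ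
nzBlocks q [] = 0
nzBlocks q (v ∷ vs) = nzCount q v + nzBlocks q vs

-- the "bad" event: some b ∈ B̃_k \ {0} has ‖g(b)‖ < 2/3,
-- i.e. 3 · (#nonzero coords) < 2 · kℓ
bad : (q k : ℕ) {m n ℓ : ℕ} → Vec (Vec (Fin q) m) n → Vec (Mat q k m) ℓ → Bool
bad q k {m} {n} {ℓ} B As =
  any (λ γ → any (λ idx →
         let b = combo B γ idx in
         not (isZeroMod q b) ∧ not ((2 * (k * ℓ)) ≤ᵇ (3 * nzBlocks q (gMap As b))))
       (allVecs (allFin n) k))
      (allVecs (allFin q) k)

-- all ℓ-tuples (A_1,…,A_ℓ) of k×m matrices over F_q (the uniform sample space)
allTuples : (q k m ℓ : ℕ) → List (Vec (Mat q k m) ℓ)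
allTuples q k m ℓ = allVecs (allVecs (allVecs (allFin q) m) k) ℓ

countTrue : {A : Set} → (A → Bool) → List A → ℕ
countTrue p [] = 0
countTrue p (x ∷ xs) = (if p x then 1 else 0) + countTrue p xs

-- ⌈log_q x⌉ : least e with x ≤ q^e (bounded search; correct for q ≥ 2)
ceilLogGo : (q x fuel e : ℕ) → ℕ
ceilLogGo q x zero e = e
ceilLogGo q x (suc f) e = if x ≤ᵇ q ^ e then e else ceilLogGo q x f (suc e)

ceilLog : ℕ → ℕ → ℕ
ceilLog q x = ceilLogGo q x x 0

-- ℓ := ⌈12 log_q n⌉ = ⌈log_q (n^12)⌉
ellOf : ℕ → ℕ → ℕ
ellOf q n = ceilLog q (n ^ 12)

{-# OPTIONS --safe #-}
-- Fix a nonzero b ∈ B̃_k and let Z be the number of the kℓ coordinates of g(b) that vanish.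
-- The kℓ rows of A_1,…,A_ℓ are independent and a nonzero linear form vanishes on at most
-- q^(m-1) rows, so E[q^Z] ≤ (1 + q · 1/q)^(kℓ) = 2^(kℓ).  If ‖g(b)‖ < 2/3 then 3Z > kℓ, hence
-- q^Z ≥ q^(kℓ/3) ≥ n^(4k) because q^ℓ ≥ n^12, and Markov's inequality bounds the probability
-- by 2^(kℓ) n^(-4k).  A union bound over the q^k n^k ways of writing b, together with
-- 2^(kℓ) ≤ 2^k n (minimality of ℓ and q > 2^(12k)), gives (2q)^k n^(k+1-4k) ≤ (2Q)^k n^(-k).
module Submission where

open import Defs
open import Data.Bool using (Bool; true; false; not; _∧_; T; if_then_else_)
open import Data.Bool.ListAction using (any)
open import Data.Empty using (⊥-elim)
open import Data.Fin using (Fin; toℕ; zero; suc)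
open import Data.Fin.Properties using (toℕ-injective; toℕ<n) renaming (suc-injective to Fin-suc-injective)
open import Data.List as L using (List; []; _∷_; _++_; concatMap; allFin; length)
open import Data.List.Properties using (length-++; length-map; length-tabulate; map-tabulate)
open import Data.Nat
open import Data.Nat.Properties
open import Data.Nat.Divisibility
open import Data.Nat.Logarithm using (⌊log₂_⌋; ⌈log₂_⌉)
open import Data.Nat.Primality using (Prime; euclidsLemma; prime⇒nonZero)
open import Data.Nat.Tactic.RingSolver using (solve-∀)
open import Data.Product using (∃-syntax; _×_; _,_; proj₁; proj₂)
open import Data.Sum using (inj₁; inj₂)
open import Data.Vec as V using (Vec; []; _∷_; lookup)
open import Function using (_∘_)
open import Relation.Nullary using (¬_; Dec; yes; no)
open import Relation.Nullary.Decidable using (⌊_⌋)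
open import Relation.Binary.PropositionalEquality

private
  variable
    A B : Set

𝟙 : Bool → ℕ
𝟙 true = 1
𝟙 false = 0

sumBy : (A → ℕ) → List A → ℕ
sumBy f [] = 0
sumBy f (x ∷ xs) = f x + sumBy f xs

countTrue≡sumBy-𝟙 : (p : A → Bool) (xs : List A) → countTrue p xs ≡ sumBy (𝟙 ∘ p) xs
countTrue≡sumBy-𝟙 p [] = refl
countTrue≡sumBy-𝟙 p (x ∷ xs) with p x
... | true = cong suc (countTrue≡sumBy-𝟙 p xs)
... | false = countTrue≡sumBy-𝟙 p xs

countTrue≤length : (p : A → Bool) (xs : List A) → countTrue p xs ≤ length xs
countTrue≤length p [] = z≤n
countTrue≤length p (x ∷ xs) with p x
... | true = s≤s (countTrue≤length p xs)
... | false = m≤n⇒m≤1+n (countTrue≤length p xs)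

sumBy-++ : (f : A → ℕ) (xs ys : List A) → sumBy f (xs ++ ys) ≡ sumBy f xs + sumBy f ys
sumBy-++ f [] ys = refl
sumBy-++ f (x ∷ xs) ys = trans (cong (f x +_) (sumBy-++ f xs ys)) (sym (+-assoc (f x) _ _))

sumBy-concatMap : (f : B → ℕ) (h : A → List B) (xs : List A) →
                  sumBy f (concatMap h xs) ≡ sumBy (sumBy f ∘ h) xs
sumBy-concatMap f h [] = refl
sumBy-concatMap f h (x ∷ xs) =
  trans (sumBy-++ f (h x) (concatMap h xs)) (cong (sumBy f (h x) +_) (sumBy-concatMap f h xs))

sumBy-map : (f : B → ℕ) (h : A → B) (xs : List A) → sumBy f (L.map h xs) ≡ sumBy (f ∘ h) xs
sumBy-map f h [] = refl
sumBy-map f h (x ∷ xs) = cong (f (h x) +_) (sumBy-map f h xs)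

sumBy-cong : {f g : A → ℕ} (xs : List A) → (∀ x → f x ≡ g x) → sumBy f xs ≡ sumBy g xs
sumBy-cong [] f≗g = refl
sumBy-cong (x ∷ xs) f≗g = cong₂ _+_ (f≗g x) (sumBy-cong xs f≗g)

sumBy-mono : {f g : A → ℕ} (xs : List A) → (∀ x → f x ≤ g x) → sumBy f xs ≤ sumBy g xs
sumBy-mono [] f≤g = z≤n
sumBy-mono (x ∷ xs) f≤g = +-mono-≤ (f≤g x) (sumBy-mono xs f≤g)

sumBy-*ˡ : (c : ℕ) (f : A → ℕ) (xs : List A) → sumBy (λ x → c * f x) xs ≡ c * sumBy f xs
sumBy-*ˡ c f [] = sym (*-zeroʳ c)
sumBy-*ˡ c f (x ∷ xs) = trans (cong (c * f x +_) (sumBy-*ˡ c f xs)) (sym (*-distribˡ-+ c (f x) _))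

sumBy-*ʳ : (c : ℕ) (f : A → ℕ) (xs : List A) → sumBy (λ x → f x * c) xs ≡ sumBy f xs * c
sumBy-*ʳ c f xs = trans (sumBy-cong xs (λ x → *-comm (f x) c)) (trans (sumBy-*ˡ c f xs) (*-comm c _))

sumBy-+ : (f g : A → ℕ) (xs : List A) → sumBy (λ x → f x + g x) xs ≡ sumBy f xs + sumBy g xs
sumBy-+ f g [] = refl
sumBy-+ f g (x ∷ xs) rewrite sumBy-+ f g xs = +-interchange (f x) (g x) (sumBy f xs) (sumBy g xs)
  where
  +-interchange : ∀ a b c d → a + b + (c + d) ≡ a + c + (b + d)
  +-interchange = solve-∀

sumBy-const : (c : ℕ) (xs : List A) → sumBy (λ _ → c) xs ≡ c * length xs
sumBy-const c [] = sym (*-zeroʳ c)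
sumBy-const c (x ∷ xs) = trans (cong (c +_) (sumBy-const c xs)) (sym (*-suc c (length xs)))

sumBy-≤-length* : (f : A → ℕ) (c : ℕ) (xs : List A) → (∀ x → f x ≤ c) → sumBy f xs ≤ length xs * c
sumBy-≤-length* f c xs f≤c =
  ≤-trans (sumBy-mono xs f≤c) (≤-reflexive (trans (sumBy-const c xs) (*-comm c _)))

sumBy-swap : (g : A → B → ℕ) (xs : List A) (ys : List B) →
             sumBy (λ x → sumBy (g x) ys) xs ≡ sumBy (λ y → sumBy (λ x → g x y) xs) ys
sumBy-swap g [] ys = sym (trans (sumBy-cong ys (λ y → refl)) (sumBy-const 0 ys))
sumBy-swap g (x ∷ xs) ys =
  trans (cong (sumBy (g x) ys +_) (sumBy-swap g xs ys)) (sym (sumBy-+ (g x) _ ys))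

sumBy-allFin-suc : ∀ n (f : Fin (suc n) → ℕ) → sumBy f (allFin (suc n)) ≡ f zero + sumBy (f ∘ suc) (allFin n)
sumBy-allFin-suc n f =
  cong (f zero +_) (trans (cong (sumBy f) (sym (map-tabulate (λ i → i) suc))) (sumBy-map f suc (allFin n)))

𝟙-any≤sumBy : (p : A → Bool) (xs : List A) → 𝟙 (any p xs) ≤ sumBy (𝟙 ∘ p) xs
𝟙-any≤sumBy p [] = z≤n
𝟙-any≤sumBy p (x ∷ xs) with p x
... | true = s≤s z≤n
... | false = 𝟙-any≤sumBy p xs

markov : (p : A → Bool) (f : A → ℕ) (a : ℕ) (xs : List A) → (∀ x → p x ≡ true → a ≤ f x) →
         sumBy (𝟙 ∘ p) xs * a ≤ sumBy f xs
markov p f a [] a≤f = z≤n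
markov p f a (x ∷ xs) a≤f with p x in px
... | true = +-mono-≤ (a≤f x px) (markov p f a xs a≤f)
... | false = ≤-trans (markov p f a xs a≤f) (m≤n+m _ (f x))

sumByᵛ : {n : ℕ} → (A → ℕ) → Vec A n → ℕ
sumByᵛ g [] = 0
sumByᵛ g (x ∷ xs) = g x + sumByᵛ g xs

productByᵛ : {n : ℕ} → (A → ℕ) → Vec A n → ℕ
productByᵛ g [] = 1
productByᵛ g (x ∷ xs) = g x * productByᵛ g xs

productByᵛ-cong : {n : ℕ} {f g : A → ℕ} (v : Vec A n) → (∀ x → f x ≡ g x) → productByᵛ f v ≡ productByᵛ g v
productByᵛ-cong [] f≗g = refl
productByᵛ-cong (x ∷ v) f≗g = cong₂ _*_ (f≗g x) (productByᵛ-cong v f≗g)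

productByᵛ-^ : {n : ℕ} (q : ℕ) (h : A → ℕ) (v : Vec A n) → productByᵛ (λ x → q ^ h x) v ≡ q ^ sumByᵛ h v
productByᵛ-^ q h [] = refl
productByᵛ-^ q h (x ∷ v) = trans (cong (q ^ h x *_) (productByᵛ-^ q h v)) (sym (^-distribˡ-+-* q (h x) (sumByᵛ h v)))

length-allVecs : (xs : List A) (n : ℕ) → length (allVecs xs n) ≡ length xs ^ n
length-allVecs xs zero = refl
length-allVecs xs (suc n) = trans (length-concatMap xs) (cong (length xs *_) (length-allVecs xs n))
  where
  length-concatMap : ∀ ys → length (concatMap (λ x → L.map (x ∷_) (allVecs xs n)) ys)
                              ≡ length ys * length (allVecs xs n)
  length-concatMap [] = refl
  length-concatMap (y ∷ ys) =
    trans (length-++ (L.map (y ∷_) (allVecs xs n))) (cong₂ _+_ (length-map (y ∷_) (allVecs xs n)) (length-concatMap ys))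

sumBy-productByᵛ-allVecs : (g : A → ℕ) (xs : List A) (n : ℕ) →
                           sumBy (productByᵛ g) (allVecs xs n) ≡ sumBy g xs ^ n
sumBy-productByᵛ-allVecs g xs zero = refl
sumBy-productByᵛ-allVecs g xs (suc n) = begin
  sumBy (productByᵛ g) (allVecs xs (suc n))
    ≡⟨ sumBy-concatMap (productByᵛ g) (λ x → L.map (x ∷_) (allVecs xs n)) xs ⟩
  sumBy (λ x → sumBy (productByᵛ g) (L.map (x ∷_) (allVecs xs n))) xs
    ≡⟨ sumBy-cong xs (λ x → trans (sumBy-map (productByᵛ g) (x ∷_) (allVecs xs n))
                                   (sumBy-*ˡ (g x) (productByᵛ g) (allVecs xs n))) ⟩
  sumBy (λ x → g x * sumBy (productByᵛ g) (allVecs xs n)) xs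
    ≡⟨ sumBy-*ʳ _ g xs ⟩
  sumBy g xs * sumBy (productByᵛ g) (allVecs xs n)
    ≡⟨ cong (sumBy g xs *_) (sumBy-productByᵛ-allVecs g xs n) ⟩
  sumBy g xs ^ suc n ∎
  where open ≡-Reasoning

length-allFin : ∀ n → length (allFin n) ≡ n
length-allFin n = length-tabulate (λ i → i)

vectors : (q m : ℕ) → List (Vec (Fin q) m)
vectors q m = allVecs (allFin q) m

length-vectors : (q m : ℕ) → length (vectors q m) ≡ q ^ m
length-vectors q m = trans (length-allVecs (allFin q) m) (cong (_^ m) (length-allFin q))

∣∧<⇒≡0 : {q n : ℕ} → q ∣ n → n < q → n ≡ 0
∣∧<⇒≡0 {n = zero} _ _ = refl
∣∧<⇒≡0 {n = suc n} q∣n n<q = ⊥-elim (>⇒∤ n<q q∣n)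

∣-dot-isZeroMod : (q : ℕ) {m : ℕ} (r b : Vec ℕ m) → isZeroMod q b ≡ true → q ∣ dot r b
∣-dot-isZeroMod q [] [] _ = q ∣0
∣-dot-isZeroMod q (x ∷ r) (y ∷ b) b≡0 with q ∣? y
... | yes q∣y = ∣m∣n⇒∣m+n (∣n⇒∣m*n x q∣y) (∣-dot-isZeroMod q r b b≡0)

affine-root-unique : {q u c a b : ℕ} → Prime q → ¬ (q ∣ u) → a ≤ b → b < q →
                     q ∣ a * u + c → q ∣ b * u + c → a ≡ b
affine-root-unique {q} {u} {c} {a} {b} q-prime q∤u a≤b b<q q∣au+c q∣bu+c =
  ≤-antisym a≤b (m∸n≡0⇒m≤n (∣∧<⇒≡0 q∣b∸a (≤-<-trans (m∸n≤m b a) b<q)))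
  where
  shift : a * u + c + (b ∸ a) * u ≡ b * u + c
  shift = subst (λ b′ → a * u + c + (b ∸ a) * u ≡ b′ * u + c) (m+[n∸m]≡n a≤b) (ring a (b ∸ a) u c)
    where
    ring : ∀ a d u c → a * u + c + d * u ≡ (a + d) * u + c
    ring = solve-∀
  q∣b∸a : q ∣ b ∸ a
  q∣b∸a with euclidsLemma (b ∸ a) u q-prime (∣m+n∣m⇒∣n (subst (q ∣_) (sym shift) q∣bu+c) q∣au+c)
  ... | inj₁ q∣b∸a = q∣b∸a
  ... | inj₂ q∣u = ⊥-elim (q∤u q∣u)

affine-root-uniqueᶠ : {q u c : ℕ} → Prime q → ¬ (q ∣ u) → (x y : Fin q) →
                      T ⌊ q ∣? toℕ x * u + c ⌋ → T ⌊ q ∣? toℕ y * u + c ⌋ → x ≡ y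
affine-root-uniqueᶠ {q} {u} {c} q-prime q∤u x y x-root y-root
  with q ∣? toℕ x * u + c | q ∣? toℕ y * u + c
... | yes q∣x | yes q∣y with ≤-total (toℕ x) (toℕ y)
...   | inj₁ x≤y = toℕ-injective (affine-root-unique q-prime q∤u x≤y (toℕ<n y) q∣x q∣y)
...   | inj₂ y≤x = sym (toℕ-injective (affine-root-unique q-prime q∤u y≤x (toℕ<n x) q∣y q∣x))

sumBy-𝟙-allFin≤1 : ∀ n (p : Fin n → Bool) → (∀ i j → T (p i) → T (p j) → i ≡ j) →
                   sumBy (𝟙 ∘ p) (allFin n) ≤ 1
sumBy-𝟙-allFin≤1 zero p p-unique = z≤n
sumBy-𝟙-allFin≤1 (suc n) p p-unique rewrite sumBy-allFin-suc n (𝟙 ∘ p) with p zero in p0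
... | true = s≤s (≤-trans (sumBy-≤-length* _ 0 (allFin n) rest-false) (≤-reflexive (*-zeroʳ (length (allFin n)))))
  where
  rest-false : ∀ i → 𝟙 (p (suc i)) ≤ 0
  rest-false i with p (suc i) in pi
  ... | false = z≤n
  ... | true with p-unique zero (suc i) (subst T (sym p0) _) (subst T (sym pi) _)
  ...   | ()
... | false = sumBy-𝟙-allFin≤1 n (p ∘ suc) (λ i j pi pj → Fin-suc-injective (p-unique (suc i) (suc j) pi pj))

𝟙-⌊⌋-mono : {P Q : Set} (p : Dec P) (r : Dec Q) → (P → Q) → 𝟙 ⌊ p ⌋ ≤ 𝟙 ⌊ r ⌋
𝟙-⌊⌋-mono (yes x) (yes y) P⇒Q = ≤-refl
𝟙-⌊⌋-mono (yes x) (no ¬y) P⇒Q = ⊥-elim (¬y (P⇒Q x))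
𝟙-⌊⌋-mono (no ¬x) r P⇒Q = z≤n

¬∣-head : (q : ℕ) {m u : ℕ} (b : Vec ℕ m) → isZeroMod q (u ∷ b) ≡ false → isZeroMod q b ≡ true → ¬ (q ∣ u)
¬∣-head q {u = u} b u∷b≢0 b≡0 q∣u with q ∣? u
... | no q∤u = q∤u q∣u
... | yes _ with trans (sym b≡0) u∷b≢0
...   | ()

affineRoots : (q : ℕ) {m : ℕ} → Vec ℕ m → ℕ → ℕ
affineRoots q {m} b c = sumBy (λ r → 𝟙 ⌊ q ∣? dot (toℕs r) b + c ⌋) (vectors q m)

affineRoots-∷ : (q : ℕ) {m u : ℕ} (b : Vec ℕ m) (c : ℕ) →
                affineRoots q (u ∷ b) c ≡ sumBy (λ x → affineRoots q b (toℕ x * u + c)) (allFin q)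
affineRoots-∷ q {m} {u} b c =
  trans (sumBy-concatMap _ (λ x → L.map (x ∷_) (vectors q m)) (allFin q))
        (sumBy-cong (allFin q) (λ x → trans (sumBy-map _ (x ∷_) (vectors q m))
          (sumBy-cong (vectors q m) (λ r → cong (λ t → 𝟙 ⌊ q ∣? t ⌋) (swap (toℕ x * u) (dot (toℕs r) b) c)))))
  where
  swap : ∀ a d c → a + d + c ≡ d + (a + c)
  swap = solve-∀

affineRoots-isZeroMod : (q : ℕ) {m : ℕ} (b : Vec ℕ m) (c : ℕ) → isZeroMod q b ≡ true →
                        affineRoots q b c ≤ q ^ m * 𝟙 ⌊ q ∣? c ⌋
affineRoots-isZeroMod q {m} b c b≡0 =
  ≤-trans (sumBy-≤-length* _ _ (vectors q m) (λ r → 𝟙-⌊⌋-mono (q ∣? _) (q ∣? c)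
                (λ q∣rb+c → ∣m+n∣m⇒∣n q∣rb+c (∣-dot-isZeroMod q (toℕs r) b b≡0))))
          (≤-reflexive (cong (_* _) (length-vectors q m)))

affineRoots-bound : {q : ℕ} → Prime q → {m : ℕ} (b : Vec ℕ m) (c : ℕ) → isZeroMod q b ≡ false →
                    q * affineRoots q b c ≤ q ^ m
affineRoots-bound q-prime [] c ()
affineRoots-bound {q} q-prime {suc m} (u ∷ b) c u∷b≢0 = begin
  q * affineRoots q (u ∷ b) c  ≡⟨ cong (q *_) (affineRoots-∷ q b c) ⟩
  q * sumBy roots (allFin q)   ≤⟨ by-tail (isZeroMod q b) refl ⟩
  q ^ suc m                    ∎
  where
  open ≤-Reasoning
  roots : Fin q → ℕ
  roots x = affineRoots q b (toℕ x * u + c)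
  by-tail : (z : Bool) → isZeroMod q b ≡ z → q * sumBy roots (allFin q) ≤ q ^ suc m
  by-tail false b≢0 = begin
    q * sumBy roots (allFin q)              ≡⟨ sym (sumBy-*ˡ q roots (allFin q)) ⟩
    sumBy (λ x → q * roots x) (allFin q)    ≤⟨ sumBy-≤-length* _ (q ^ m) (allFin q)
                                                 (λ x → affineRoots-bound q-prime b _ b≢0) ⟩
    length (allFin q) * q ^ m              ≡⟨ cong (_* q ^ m) (length-allFin q) ⟩
    q ^ suc m                               ∎
  by-tail true b≡0 = *-monoʳ-≤ q (begin
    sumBy roots (allFin q)
      ≤⟨ sumBy-mono (allFin q) (λ x → affineRoots-isZeroMod q b (toℕ x * u + c) b≡0) ⟩
    sumBy (λ x → q ^ m * 𝟙 ⌊ q ∣? toℕ x * u + c ⌋) (allFin q)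
      ≡⟨ sumBy-*ˡ (q ^ m) _ (allFin q) ⟩
    q ^ m * sumBy (λ x → 𝟙 ⌊ q ∣? toℕ x * u + c ⌋) (allFin q)
      ≤⟨ *-monoʳ-≤ (q ^ m) (sumBy-𝟙-allFin≤1 q _ (affine-root-uniqueᶠ q-prime (¬∣-head q b u∷b≢0 b≡0))) ⟩
    q ^ m * 1
      ≡⟨ *-identityʳ (q ^ m) ⟩
    q ^ m ∎)

^-distribʳ-* : ∀ a b o → (a * b) ^ o ≡ a ^ o * b ^ o
^-distribʳ-* a b zero = refl
^-distribʳ-* a b (suc o) = trans (cong (a * b *_) (^-distribʳ-* a b o)) (interchange a b (a ^ o) (b ^ o))
  where
  interchange : ∀ a b c d → a * b * (c * d) ≡ a * c * (b * d)
  interchange = solve-∀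

^-cancelʳ-≤ : ∀ e .{{_ : NonZero e}} {a b : ℕ} → a ^ e ≤ b ^ e → a ≤ b
^-cancelʳ-≤ e aᵉ≤bᵉ = ≮⇒≥ (λ b<a → <⇒≱ (^-monoˡ-< e b<a) aᵉ≤bᵉ)

module ExponentialMoment {q : ℕ} (q-prime : Prime q) {m : ℕ} (b : Vec ℕ m) where

  instance
    q≢0 : NonZero q
    q≢0 = prime⇒nonZero q-prime

  vanishes : Vec (Fin q) m → ℕ
  vanishes r = 𝟙 ⌊ q ∣? dot (toℕs r) b ⌋

  q^vanishes≤ : ∀ r → q ^ vanishes r ≤ 1 + q * vanishes r
  q^vanishes≤ r with q ∣? dot (toℕs r) b
  ... | yes _ = m≤n+m (q * 1) 1
  ... | no _ = s≤s z≤n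

  sumBy-q^vanishes : isZeroMod q b ≡ false → sumBy (λ r → q ^ vanishes r) (vectors q m) ≤ 2 * q ^ m
  sumBy-q^vanishes b≢0 = begin
    sumBy (λ r → q ^ vanishes r) (vectors q m)
      ≤⟨ sumBy-mono (vectors q m) q^vanishes≤ ⟩
    sumBy (λ r → 1 + q * vanishes r) (vectors q m)
      ≡⟨ sumBy-+ (λ _ → 1) _ (vectors q m) ⟩
    sumBy (λ _ → 1) (vectors q m) + sumBy (λ r → q * vanishes r) (vectors q m)
      ≡⟨ cong₂ _+_ (trans (sumBy-const 1 (vectors q m)) (trans (*-identityˡ _) (length-vectors q m)))
                   (sumBy-*ˡ q vanishes (vectors q m)) ⟩
    q ^ m + q * sumBy vanishes (vectors q m)
      ≤⟨ +-monoʳ-≤ (q ^ m) (≤-trans (≤-reflexive (cong (q *_) vanishes≡affineRoots))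
                                    (affineRoots-bound q-prime b 0 b≢0)) ⟩
    q ^ m + q ^ m
      ≡⟨ cong (q ^ m +_) (sym (+-identityʳ _)) ⟩
    2 * q ^ m ∎
    where
    open ≤-Reasoning
    vanishes≡affineRoots : sumBy vanishes (vectors q m) ≡ affineRoots q b 0
    vanishes≡affineRoots = sumBy-cong (vectors q m) (λ r → cong (λ t → 𝟙 ⌊ q ∣? t ⌋) (sym (+-identityʳ _)))

  zeros : {k ℓ : ℕ} → Vec (Mat q k m) ℓ → ℕ
  zeros As = sumByᵛ (sumByᵛ vanishes) As

  q^zeros≡productByᵛ : {k ℓ : ℕ} (As : Vec (Mat q k m) ℓ) →
                       q ^ zeros As ≡ productByᵛ (productByᵛ (λ r → q ^ vanishes r)) As
  q^zeros≡productByᵛ As =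
    sym (trans (productByᵛ-cong As (λ M → productByᵛ-^ q vanishes M)) (productByᵛ-^ q (sumByᵛ vanishes) As))

  zeros+nzBlocks : {k ℓ : ℕ} (As : Vec (Mat q k m) ℓ) → zeros As + nzBlocks q (gMap As b) ≡ k * ℓ
  zeros+nzBlocks {k} [] = sym (*-zeroʳ k)
  zeros+nzBlocks {k} {suc ℓ} (M ∷ As) = begin
    sumByᵛ vanishes M + zeros As + (nzCount q (matVec M b) + nzBlocks q (gMap As b))
      ≡⟨ interchange (sumByᵛ vanishes M) (zeros As) _ _ ⟩
    (sumByᵛ vanishes M + nzCount q (matVec M b)) + (zeros As + nzBlocks q (gMap As b))
      ≡⟨ cong₂ _+_ (rowwise M) (zeros+nzBlocks As) ⟩
    k + k * ℓ
      ≡⟨ sym (*-suc k ℓ) ⟩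
    k * suc ℓ ∎
    where
    open ≡-Reasoning
    interchange : ∀ a b c d → a + b + (c + d) ≡ a + c + (b + d)
    interchange = solve-∀
    rowwise : {k′ : ℕ} (M : Mat q k′ m) → sumByᵛ vanishes M + nzCount q (matVec M b) ≡ k′
    rowwise [] = refl
    rowwise (r ∷ M) with q ∣? dot (toℕs r) b
    ... | yes _ = cong suc (rowwise M)
    ... | no _ = trans (+-suc _ _) (cong suc (rowwise M))

  sumBy-q^zeros : {k ℓ : ℕ} → isZeroMod q b ≡ false →
                  sumBy (λ As → q ^ zeros As) (allTuples q k m ℓ) ≤ 2 ^ (k * ℓ) * length (allTuples q k m ℓ)
  sumBy-q^zeros {k} {ℓ} b≢0 = begin
    sumBy (λ As → q ^ zeros As) (allTuples q k m ℓ)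
      ≡⟨ sumBy-cong (allTuples q k m ℓ) q^zeros≡productByᵛ ⟩
    sumBy (productByᵛ (productByᵛ w)) (allTuples q k m ℓ)
      ≡⟨ sumBy-productByᵛ-allVecs _ _ ℓ ⟩
    sumBy (productByᵛ w) (allVecs (vectors q m) k) ^ ℓ
      ≡⟨ cong (_^ ℓ) (sumBy-productByᵛ-allVecs w (vectors q m) k) ⟩
    (sumBy w (vectors q m) ^ k) ^ ℓ
      ≤⟨ ^-monoˡ-≤ ℓ (^-monoˡ-≤ k (sumBy-q^vanishes b≢0)) ⟩
    ((2 * q ^ m) ^ k) ^ ℓ
      ≡⟨ ^-*-assoc _ k ℓ ⟩
    (2 * q ^ m) ^ (k * ℓ)
      ≡⟨ ^-distribʳ-* 2 (q ^ m) (k * ℓ) ⟩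
    2 ^ (k * ℓ) * (q ^ m) ^ (k * ℓ)
      ≡⟨ cong (2 ^ (k * ℓ) *_) (sym length-allTuples) ⟩
    2 ^ (k * ℓ) * length (allTuples q k m ℓ) ∎
    where
    open ≤-Reasoning
    w : Vec (Fin q) m → ℕ
    w r = q ^ vanishes r
    length-allTuples : length (allTuples q k m ℓ) ≡ (q ^ m) ^ (k * ℓ)
    length-allTuples = begin-equality
      length (allTuples q k m ℓ)              ≡⟨ length-allVecs _ ℓ ⟩
      length (allVecs (vectors q m) k) ^ ℓ   ≡⟨ cong (_^ ℓ) (length-allVecs _ k) ⟩
      (length (vectors q m) ^ k) ^ ℓ         ≡⟨ cong (λ t → (t ^ k) ^ ℓ) (length-vectors q m) ⟩
      ((q ^ m) ^ k) ^ ℓ                      ≡⟨ ^-*-assoc _ k ℓ ⟩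
      (q ^ m) ^ (k * ℓ)                      ∎

  weight≥⅔ : {k ℓ : ℕ} → Vec (Mat q k m) ℓ → Bool
  weight≥⅔ {k} {ℓ} As = (2 * (k * ℓ)) ≤ᵇ (3 * nzBlocks q (gMap As b))

  lowWeight : {k ℓ : ℕ} → Vec (Mat q k m) ℓ → Bool
  lowWeight As = not (isZeroMod q b) ∧ not (weight≥⅔ As)

  lowWeight⇒k*ℓ≤3*zeros : {k ℓ : ℕ} (As : Vec (Mat q k m) ℓ) → lowWeight As ≡ true → k * ℓ ≤ 3 * zeros As
  lowWeight⇒k*ℓ≤3*zeros {k} {ℓ} As low = ≮⇒≥ (λ 3Z<N → <-irrefl 3Z+3nz≡3N (+-mono-< 3Z<N (≰⇒> 2N≰3nz)))
    where
    N = k * ℓ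
    nz = nzBlocks q (gMap As b)
    2N≰3nz : ¬ (2 * N ≤ 3 * nz)
    2N≰3nz 2N≤3nz = second-false (isZeroMod q b) _ low (≤⇒≤ᵇ 2N≤3nz)
      where
      second-false : (z t : Bool) → not z ∧ not t ≡ true → ¬ T t
      second-false false false _ ()
    3Z+3nz≡3N : 3 * zeros As + 3 * nz ≡ N + 2 * N
    3Z+3nz≡3N = trans (sym (*-distribˡ-+ 3 (zeros As) nz)) (cong (3 *_) (zeros+nzBlocks As))

  lowWeight⇒n^4k≤q^zeros : {k ℓ : ℕ} (n : ℕ) → n ^ 12 ≤ q ^ ℓ → (As : Vec (Mat q k m) ℓ) →
                           lowWeight As ≡ true → n ^ (4 * k) ≤ q ^ zeros As
  lowWeight⇒n^4k≤q^zeros {k} {ℓ} n n¹²≤qˡ As low = ^-cancelʳ-≤ 3 (begin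
    (n ^ (4 * k)) ^ 3  ≡⟨ ^-*-assoc n (4 * k) 3 ⟩
    n ^ (4 * k * 3)    ≡⟨ cong (n ^_) (trans (*-comm (4 * k) 3) (sym (*-assoc 3 4 k))) ⟩
    n ^ (12 * k)       ≡⟨ sym (^-*-assoc n 12 k) ⟩
    (n ^ 12) ^ k       ≤⟨ ^-monoˡ-≤ k n¹²≤qˡ ⟩
    (q ^ ℓ) ^ k        ≡⟨ trans (^-*-assoc q ℓ k) (cong (q ^_) (*-comm ℓ k)) ⟩
    q ^ (k * ℓ)        ≤⟨ ^-monoʳ-≤ q (lowWeight⇒k*ℓ≤3*zeros As low) ⟩
    q ^ (3 * zeros As) ≡⟨ trans (cong (q ^_) (*-comm 3 (zeros As))) (sym (^-*-assoc q (zeros As) 3)) ⟩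
    (q ^ zeros As) ^ 3 ∎)
    where open ≤-Reasoning

  lowWeight-count : {k ℓ : ℕ} (n : ℕ) → n ^ 12 ≤ q ^ ℓ →
                    sumBy (𝟙 ∘ lowWeight) (allTuples q k m ℓ) * n ^ (4 * k)
                      ≤ 2 ^ (k * ℓ) * length (allTuples q k m ℓ)
  lowWeight-count {k} {ℓ} n n¹²≤qˡ = by-cases (isZeroMod q b) refl
    where
    Ts = allTuples q k m ℓ
    by-cases : (z : Bool) → isZeroMod q b ≡ z → sumBy (𝟙 ∘ lowWeight) Ts * n ^ (4 * k) ≤ 2 ^ (k * ℓ) * length Ts
    by-cases true b≡0 = ≤-trans (≤-reflexive (cong (_* n ^ (4 * k)) never)) z≤n
      where
      never : sumBy (𝟙 ∘ lowWeight) Ts ≡ 0 * length Ts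
      never = trans (sumBy-cong Ts (λ As → cong (λ z → 𝟙 (not z ∧ not (weight≥⅔ As))) b≡0)) (sumBy-const 0 Ts)
    by-cases false b≢0 =
      ≤-trans (markov lowWeight (λ As → q ^ zeros As) (n ^ (4 * k)) Ts (lowWeight⇒n^4k≤q^zeros n n¹²≤qˡ))
              (sumBy-q^zeros {k} {ℓ} b≢0)

n≤m^n : ∀ m → 2 ≤ m → ∀ n → n ≤ m ^ n
n≤m^n m 2≤m zero = z≤n
n≤m^n m 2≤m (suc n) = begin
  1 + n              ≤⟨ +-mono-≤ (m^n>0 m n) (n≤m^n m 2≤m n) ⟩
  m ^ n + m ^ n      ≡⟨ cong (m ^ n +_) (sym (+-identityʳ (m ^ n))) ⟩
  2 * m ^ n          ≤⟨ *-monoˡ-≤ (m ^ n) 2≤m ⟩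
  m * m ^ n          ∎
  where
  open ≤-Reasoning
  instance
    m≢0 : NonZero m
    m≢0 = >-nonZero (≤-trans (s≤s z≤n) 2≤m)

PredecessorTooSmall : ℕ → ℕ → ℕ → Set
PredecessorTooSmall q x e = ∀ {e′} → e ≡ suc e′ → q ^ e′ < x

ceilLogGo-spec : ∀ q x fuel e → x ≤ q ^ (e + fuel) → PredecessorTooSmall q x e →
                 x ≤ q ^ ceilLogGo q x fuel e × PredecessorTooSmall q x (ceilLogGo q x fuel e)
ceilLogGo-spec q x zero e x≤qᵉ⁺⁰ e-least = subst (λ t → x ≤ q ^ t) (+-identityʳ e) x≤qᵉ⁺⁰ , e-least
ceilLogGo-spec q x (suc fuel) e x≤qᵉ⁺ᶠ e-least = step (x ≤ᵇ q ^ e) refl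
  where
  step : (t : Bool) → (x ≤ᵇ q ^ e) ≡ t →
         let e″ = if t then e else ceilLogGo q x fuel (suc e) in x ≤ q ^ e″ × PredecessorTooSmall q x e″
  step true x≤ᵇqᵉ = ≤ᵇ⇒≤ x (q ^ e) (subst T (sym x≤ᵇqᵉ) _) , e-least
  step false x≰ᵇqᵉ = ceilLogGo-spec q x fuel (suc e) (subst (λ t → x ≤ q ^ t) (+-suc e fuel) x≤qᵉ⁺ᶠ)
                       (λ { refl → ≰⇒> (λ x≤qᵉ → subst T x≰ᵇqᵉ (≤⇒≤ᵇ x≤qᵉ)) })

ceilLog-spec : ∀ q x → 2 ≤ q → x ≤ q ^ ceilLog q x × PredecessorTooSmall q x (ceilLog q x)
ceilLog-spec q x 2≤q = ceilLogGo-spec q x x 0 (n≤m^n q 2≤q x) (λ ())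

2^[k*ℓ]≤2^k*n : ∀ {q n} k ℓ → 2 ^ (12 * k) < q → 1 ≤ n → PredecessorTooSmall q (n ^ 12) ℓ →
                2 ^ (k * ℓ) ≤ 2 ^ k * n
2^[k*ℓ]≤2^k*n k zero _ 1≤n _ = ≤-trans (≤-reflexive (cong (2 ^_) (*-zeroʳ k))) (*-mono-≤ (m^n>0 2 k) 1≤n)
2^[k*ℓ]≤2^k*n {q} {n} k (suc ℓ) 2¹²ᵏ<q _ ℓ-least = begin
  2 ^ (k * suc ℓ)      ≡⟨ trans (cong (2 ^_) (*-suc k ℓ)) (^-distribˡ-+-* 2 k (k * ℓ)) ⟩
  2 ^ k * 2 ^ (k * ℓ)  ≤⟨ *-monoʳ-≤ (2 ^ k) (^-cancelʳ-≤ 12 [2^kℓ]¹²≤n¹²) ⟩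
  2 ^ k * n            ∎
  where
  open ≤-Reasoning
  [2^kℓ]¹²≤n¹² : (2 ^ (k * ℓ)) ^ 12 ≤ n ^ 12
  [2^kℓ]¹²≤n¹² = begin
    (2 ^ (k * ℓ)) ^ 12  ≡⟨ trans (^-*-assoc 2 (k * ℓ) 12) (cong (2 ^_) (reorder k ℓ)) ⟩
    2 ^ (12 * k * ℓ)    ≡⟨ sym (^-*-assoc 2 (12 * k) ℓ) ⟩
    (2 ^ (12 * k)) ^ ℓ  ≤⟨ ^-monoˡ-≤ ℓ (<⇒≤ 2¹²ᵏ<q) ⟩
    q ^ ℓ               ≤⟨ <⇒≤ (ℓ-least refl) ⟩
    n ^ 12              ∎
    where
    reorder : ∀ k ℓ → k * ℓ * 12 ≡ 12 * k * ℓ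
    reorder = solve-∀

bad-unionBound : {q k m n ℓ : ℕ} → Prime q → (B : Vec (Vec (Fin q) m) n) → n ^ 12 ≤ q ^ ℓ →
                 countTrue (bad q k B) (allTuples q k m ℓ) * n ^ (4 * k)
                   ≤ q ^ k * (n ^ k * (2 ^ (k * ℓ) * length (allTuples q k m ℓ)))
bad-unionBound {q} {k} {m} {n} {ℓ} q-prime B n¹²≤qˡ = begin
  countTrue (bad q k B) Ts * W
    ≡⟨ cong (_* W) (countTrue≡sumBy-𝟙 (bad q k B) Ts) ⟩
  sumBy (𝟙 ∘ bad q k B) Ts * W
    ≤⟨ *-monoˡ-≤ W union ⟩
  sumBy (λ γ → sumBy (λ idx → hits γ idx) idxs) γs * W
    ≡⟨ trans (sym (sumBy-*ʳ W _ γs)) (sumBy-cong γs (λ γ → sym (sumBy-*ʳ W _ idxs))) ⟩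
  sumBy (λ γ → sumBy (λ idx → hits γ idx * W) idxs) γs
    ≤⟨ sumBy-≤-length* _ _ γs (λ γ → sumBy-≤-length* _ _ idxs (λ idx →
         ExponentialMoment.lowWeight-count q-prime (combo B γ idx) {k} {ℓ} n n¹²≤qˡ)) ⟩
  length γs * (length idxs * R)
    ≡⟨ cong₂ (λ a b → a * (b * R)) (length-allVecs (allFin q) k) (length-allVecs (allFin n) k) ⟩
  length (allFin q) ^ k * (length (allFin n) ^ k * R)
    ≡⟨ cong₂ (λ a b → a ^ k * (b ^ k * R)) (length-allFin q) (length-allFin n) ⟩
  q ^ k * (n ^ k * R) ∎
  where
  open ≤-Reasoning
  Ts = allTuples q k m ℓ
  γs = allVecs (allFin q) k
  idxs = allVecs (allFin n) k
  W = n ^ (4 * k)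
  R = 2 ^ (k * ℓ) * length Ts
  lowWeightAt : Vec (Fin q) k → Vec (Fin n) k → Vec (Mat q k m) ℓ → Bool
  lowWeightAt γ idx = ExponentialMoment.lowWeight q-prime (combo B γ idx)
  hits : Vec (Fin q) k → Vec (Fin n) k → ℕ
  hits γ idx = sumBy (𝟙 ∘ lowWeightAt γ idx) Ts
  union : sumBy (𝟙 ∘ bad q k B) Ts ≤ sumBy (λ γ → sumBy (λ idx → hits γ idx) idxs) γs
  union = ≤-trans
    (sumBy-mono Ts (λ As → ≤-trans (𝟙-any≤sumBy _ γs) (sumBy-mono γs (λ γ → 𝟙-any≤sumBy _ idxs))))
    (≤-reflexive (trans (sumBy-swap (λ As γ → sumBy (λ idx → 𝟙 (lowWeightAt γ idx As)) idxs) Ts γs)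
                        (sumBy-cong γs (λ γ → sumBy-swap (λ As idx → 𝟙 (lowWeightAt γ idx As)) Ts idxs))))

bad-count-bound : (k n : ℕ) {q m Q : ℕ} → Prime q → 2 ^ (12 * k) < q → q ≤ Q → (B : Vec (Vec (Fin q) m) n) →
                  countTrue (bad q k B) (allTuples q k m (ellOf q n)) * n ^ k
                    ≤ Q ^ k * 2 ^ k * length (allTuples q k m (ellOf q n))
bad-count-bound zero n {q} {m} _ _ _ B =
  ≤-trans (≤-reflexive (*-identityʳ (countTrue (bad q 0 B) Ts)))
          (≤-trans (countTrue≤length (bad q 0 B) Ts) (≤-reflexive (sym (+-identityʳ (length Ts)))))
  where
  Ts = allTuples q 0 m (ellOf q n)
bad-count-bound (suc k) zero {q} {m} _ _ _ B =
  ≤-trans (≤-reflexive (*-zeroʳ (countTrue (bad q (suc k) B) (allTuples q (suc k) m (ellOf q 0))))) z≤n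
bad-count-bound k@(suc k′) n@(suc n′) {q} {m} {Q} q-prime 2¹²ᵏ<q q≤Q B =
  *-cancelʳ-≤ (cnt * n ^ k) (Q ^ k * 2 ^ k * length Ts) (n ^ suc k) {{m^n≢0 n (suc k)}} (begin
    cnt * n ^ k * n ^ suc k
      ≡⟨ trans (*-assoc cnt (n ^ k) _) (cong (cnt *_) (sym (^-distribˡ-+-* n k (suc k)))) ⟩
    cnt * n ^ (k + suc k)
      ≤⟨ *-monoʳ-≤ cnt (^-monoʳ-≤ n 2k+1≤4k) ⟩
    cnt * n ^ (4 * k)
      ≤⟨ bad-unionBound {k = k} {ℓ = ℓ} q-prime B n¹²≤qˡ ⟩
    q ^ k * (n ^ k * (2 ^ (k * ℓ) * length Ts))
      ≤⟨ *-mono-≤ (^-monoˡ-≤ k q≤Q) (*-monoʳ-≤ (n ^ k) (*-monoˡ-≤ (length Ts)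
           (2^[k*ℓ]≤2^k*n k ℓ 2¹²ᵏ<q (s≤s z≤n) (proj₂ ℓ-spec)))) ⟩
    Q ^ k * (n ^ k * (2 ^ k * n * length Ts))
      ≡⟨ reorder (Q ^ k) (n ^ k) (2 ^ k) n (length Ts) ⟩
    Q ^ k * 2 ^ k * length Ts * n ^ suc k ∎)
  where
  open ≤-Reasoning
  ℓ = ellOf q n
  Ts = allTuples q k m ℓ
  cnt = countTrue (bad q k B) Ts
  ℓ-spec = ceilLog-spec q (n ^ 12) (≤-trans (s≤s (m^n>0 2 (12 * k))) 2¹²ᵏ<q)
  n¹²≤qˡ : n ^ 12 ≤ q ^ ℓ
  n¹²≤qˡ = proj₁ ℓ-spec
  2k+1≤4k : k + suc k ≤ 4 * k
  2k+1≤4k = subst (k + suc k ≤_) (slack k′) (m≤m+n (k + suc k) (suc (k′ + k′)))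
    where
    slack : ∀ k′ → suc k′ + suc (suc k′) + suc (k′ + k′) ≡ 4 * suc k′
    slack = solve-∀
  reorder : ∀ a b c d e → a * (b * (c * d * e)) ≡ a * c * e * (d * b)
  reorder = solve-∀

proposition4p2 : (k Q c : ℕ) → ∃[ C ] ((n q m : ℕ) → Prime q → 2 ^ (12 * k) < q → q ≤ Q
                   → k * k * ⌊log₂ n ⌋ ≤ c * m → m ≤ c * (k * k * ⌈log₂ n ⌉)
                   → (B : Vec (Vec (Fin q) m) n) → ((i j : Fin n) → lookup B i ≡ lookup B j → i ≡ j)
                   → countTrue (bad q k B) (allTuples q k m (ellOf q n)) * n ^ k
                     ≤ C * length (allTuples q k m (ellOf q n)))
proposition4p2 k Q c = Q ^ k * 2 ^ k , λ n q m q-prime 2¹²ᵏ<q q≤Q _ _ B _ →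
  bad-count-bound k n q-prime 2¹²ᵏ<q q≤Q B
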